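{- Let $G$ be a tight graph with set $T$ of dense vertices, let $S'\subseteq\delta T$, and let $c'$ be an $S'$-partial b-colouring of $G$. If $c$ is a b-precolouring extension of $c'$ in $G$, then $c$ is a tight b-colouring of $G$.
   Context: Graphs are finite and simple. A colouring of $G=(V,E)$ is a map $c:V\to\mathbb{Z}^+$ with $c(u)\ne c(v)$ for every edge $uv$; it uses $|c(V)|$ colours. A vertex is b-chromatic if it is adjacent to a vertex of every colour other than its own; a b-colouring is a colouring in which every colour class has a b-chromatic vertex. $m(G)$ is the largest $k$ such that $G$ has at least $k$ vertices of degree at least $k-1$; a vertex of degree at least $m(G)-1$ is dense; $G$ is tight if it has exactly $m(G)$ dense vertices, each of degree exactly $m(G)-1$. A tight b-colouring is a b-colouring with exactly $m(G)$ colours. For $S\subseteq V$, $\delta S=\left(\bigcup_{u\in S}N(u)\right)\setminus S$. For $S'\subseteq\delta T$, an $S'$-partial b-colouring of $G$ is a colouring $c'$ of the induced subgraph $G[S'\cup T]$ such that (1) $c'(u)\ne c'(u')$ for all distinct $u,u'\in T$, and (2) for every $u\in T$ with $c'(u)=c'(s)$ for some $s\in S'$, every vertex of $T\setminus\{u\}$ has exactly one neighbour of colour $c'(u)$. A b-precolouring extension of $c'$ in $G$ is a b-colouring $c$ of $G$ such that (1) $c(v)=c'(v)$ for all $v\in S'\cup T$, and (2) every colour class of $c$ containing at least two vertices of $\delta T$ contains no vertex of $\delta T\setminus S'$. -}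

module Defs where

open import Data.Nat using (ℕ; zero; suc; _≤_; _<_; _∸_; _≤?_; _≟_)
open import Data.Fin using (Fin)
open import Data.Fin.Subset using (Subset; _∈_; _∉_)
open import Data.Bool using (Bool; true; false; if_then_else_)
open import Data.List using (List; length; map; filter; deduplicate; sum)
open import Data.Product using (Σ; _×_; ∃; ∃-syntax; _,_)
open import Relation.Binary.PropositionalEquality using (_≡_; _≢_)
open import Relation.Nullary using (¬_; does)
import Data.List as L
open import Data.Sum using (_⊎_)
import Data.Bool as B

record Graph (n : ℕ) : Set where
  field
    adj   : Fin n → Fin n → Bool
    sym   : ∀ u v → adj u v ≡ adj v u
    irrefl : ∀ v → adj v v ≡ false
open Graph public

module _ {n : ℕ} (G : Graph n) where

  vertices : List (Fin n)
  vertices = L.tabulate (λ i → i)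

  Adj : Fin n → Fin n → Set
  Adj u v = adj G u v ≡ true

  deg : Fin n → ℕ
  deg v = length (filter (λ u → adj G v u B.≟ true) vertices)

  countDegAtLeast : ℕ → ℕ
  countDegAtLeast k = length (filter (λ v → (k ∸ 1) ≤? deg v) vertices)

  mFrom : ℕ → ℕ
  mFrom zero = zero
  mFrom (suc k) with does (suc k ≤? countDegAtLeast (suc k))
  ... | true  = suc k
  ... | false = mFrom k

  -- m(G); any admissible k satisfies k ≤ n, so searching from n suffices
  m : ℕ
  m = mFrom n

  Dense : Fin n → Set
  Dense v = m ∸ 1 ≤ deg v

  Tight : Set
  Tight = length (filter (λ v → (m ∸ 1) ≤? deg v) vertices) ≡ m
        × (∀ v → Dense v → deg v ≡ m ∸ 1)

  IsColouring : (Fin n → ℕ) → Set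
  IsColouring c = (∀ v → 0 < c v) × (∀ u v → Adj u v → c u ≢ c v)

  numColours : (Fin n → ℕ) → ℕ
  numColours c = length (deduplicate _≟_ (L.map c vertices))

  BChromatic : (Fin n → ℕ) → Fin n → Set
  BChromatic c v = ∀ w → c w ≢ c v → ∃[ u ] (Adj v u × c u ≡ c w)

  IsBColouring : (Fin n → ℕ) → Set
  IsBColouring c = IsColouring c × (∀ v → ∃[ u ] (c u ≡ c v × BChromatic c u))

  IsTightBColouring : (Fin n → ℕ) → Set
  IsTightBColouring c = IsBColouring c × numColours c ≡ m

  InT : Fin n → Set
  InT = Dense

  InδT : Fin n → Set
  InδT v = ¬ InT v × ∃[ u ] (InT u × Adj u v)

  InS'T : Subset n → Fin n → Set
  InS'T S' v = (v ∈ S') ⊎ InT v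

  -- S'-partial b-colouring (c' given as a function on all of V; only its
  -- values on S' ∪ T matter)
  IsPartialBColouring : Subset n → (Fin n → ℕ) → Set
  IsPartialBColouring S' c' =
      (∀ v → InS'T S' v → 0 < c' v)
    × (∀ u v → InS'T S' u → InS'T S' v → Adj u v → c' u ≢ c' v)
    × (∀ u u' → InT u → InT u' → u ≢ u' → c' u ≢ c' u')
    × (∀ u → InT u → (∃[ s ] (s ∈ S' × c' u ≡ c' s)) →
         ∀ w → InT w → w ≢ u →
           ∃[ x ] ((InS'T S' x × Adj w x × c' x ≡ c' u)
                  × (∀ y → InS'T S' y → Adj w y → c' y ≡ c' u → y ≡ x)))

  IsBPrecolouringExtension : Subset n → (Fin n → ℕ) → (Fin n → ℕ) → Set
  IsBPrecolouringExtension S' c' c =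
      IsBColouring c
    × (∀ v → InS'T S' v → c v ≡ c' v)
    × (∀ x y → InδT x → InδT y → x ≢ y → c x ≡ c y →
         ∀ z → InδT z → c z ≡ c x → z ∈ S')

-- A b-colouring with k colours has k b-chromatic vertices of pairwise distinct
-- colours, each of degree at least k - 1, so k ≤ m(G).  Conversely, c agrees
-- with c' on the m(G) vertices of T, on which c' is injective, so c uses at
-- least m(G) colours.
module Submission where

open import Defs
open import Data.Nat using (ℕ)
open import Data.Fin using (Fin)
open import Data.Fin.Subset using (Subset)

open import Data.Nat using (zero; suc; _≤_; _∸_; _≤?_; z≤n; s≤s; _≟_)
open import Data.Nat.Properties using (≤-antisym; ≤-pred; ≤∧≢⇒<; ∸-monoˡ-≤)
open import Data.Bool using (true; false)
import Data.Bool as Bool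
open import Data.List using (List; []; _∷_; length; map; filter; deduplicate)
open import Data.List.Properties using (length-map; length-tabulate; length-removeAt′)
open import Data.List.Membership.Propositional using (_∈_)
open import Data.List.Membership.Propositional.Properties
  using (∈-map⁺; ∈-map⁻; ∈-filter⁺; ∈-filter⁻; ∈-deduplicate⁺; ∈-deduplicate⁻; ∈-tabulate⁺)
open import Data.List.Relation.Binary.Subset.Propositional using (_⊆_)
open import Data.List.Relation.Unary.Any using (here; there; index; _─_)
import Data.List.Relation.Unary.All as All
open import Data.List.Relation.Unary.AllPairs using ([]; _∷_)
open import Data.List.Relation.Unary.Unique.Propositional using (Unique)
open import Data.List.Relation.Unary.Unique.Propositional.Properties using (filter⁺; tabulate⁺)
open import Data.List.Relation.Unary.Unique.DecPropositional.Properties _≟_ using (deduplicate-!)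
open import Data.Product using (∃-syntax; _×_; _,_; proj₂)
open import Data.Sum using (inj₂)
open import Relation.Binary.PropositionalEquality
  using (_≡_; _≢_; refl; trans; subst)
import Relation.Binary.PropositionalEquality as ≡
open import Relation.Nullary using (¬_; yes; no; Dec; does)
open import Data.Empty using (⊥-elim)

module _ {A : Set} where

  ∈-─⁺ : ∀ {x z : A} {ys} (p : x ∈ ys) → z ∈ ys → z ≢ x → z ∈ (ys ─ p)
  ∈-─⁺ (here refl) (here refl) z≢x = ⊥-elim (z≢x refl)
  ∈-─⁺ (here refl) (there q)   _   = q
  ∈-─⁺ (there p)   (here refl) _   = here refl
  ∈-─⁺ (there p)   (there q)   z≢x = there (∈-─⁺ p q z≢x)

  Unique-⊆⇒length≤ : ∀ {xs ys : List A} → Unique xs → xs ⊆ ys → length xs ≤ length ys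
  Unique-⊆⇒length≤ {[]}     _           _  = z≤n
  Unique-⊆⇒length≤ {x ∷ xs} {ys} (x∉xs ∷ xs!) xs⊆ys =
    subst (suc (length xs) ≤_) (≡.sym (length-removeAt′ ys (index x∈ys)))
      (s≤s (Unique-⊆⇒length≤ xs! λ z∈xs →
        ∈-─⁺ x∈ys (xs⊆ys (there z∈xs)) (λ z≡x → All.lookup x∉xs z∈xs (≡.sym z≡x))))
    where
    x∈ys : x ∈ ys
    x∈ys = xs⊆ys (here refl)

Unique-map⁺ : ∀ {A B : Set} (f : A → B) {xs : List A} →
  (∀ {x y} → x ∈ xs → y ∈ xs → x ≢ y → f x ≢ f y) → Unique xs → Unique (map f xs)
Unique-map⁺ f {[]}     _     []           = []
Unique-map⁺ f {x ∷ xs} f-inj (x∉xs ∷ xs!) =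
  All.tabulate (λ fy∈ → let y , y∈xs , fy≡ = ∈-map⁻ f fy∈ in
    λ fx≡ → f-inj (here refl) (there y∈xs) (All.lookup x∉xs y∈xs) (trans fx≡ fy≡))
  ∷ Unique-map⁺ f (λ p q → f-inj (there p) (there q)) xs!

does≡false⇒¬ : ∀ {P : Set} (P? : Dec P) → does P? ≡ false → ¬ P
does≡false⇒¬ (no ¬p) _ = ¬p

module _ {n : ℕ} (G : Graph n) where

  ∈-vertices : ∀ v → v ∈ vertices G
  ∈-vertices = ∈-tabulate⁺

  mFrom-maximal : ∀ j k → k ≤ j → k ≤ countDegAtLeast G k → k ≤ mFrom G j
  mFrom-maximal zero    .zero z≤n _ = z≤n
  mFrom-maximal (suc j) k k≤1+j k≤count
    with does (suc j ≤? countDegAtLeast G (suc j)) in found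
  ... | true  = k≤1+j
  ... | false with k ≟ suc j
  ...   | yes refl = ⊥-elim (does≡false⇒¬ (suc j ≤? countDegAtLeast G (suc j)) found k≤count)
  ...   | no  k≢1+j = mFrom-maximal j k (≤-pred (≤∧≢⇒< k≤1+j k≢1+j)) k≤count

  m-maximal : ∀ k → k ≤ n → k ≤ countDegAtLeast G k → k ≤ m G
  m-maximal = mFrom-maximal n

  module _ (c : Fin n → ℕ) where

    colours : List ℕ
    colours = deduplicate _≟_ (map c (vertices G))

    numColours≤length : ∀ (xs : List (Fin n)) →
      (∀ v → ∃[ u ] (u ∈ xs × c u ≡ c v)) → numColours G c ≤ length xs
    numColours≤length xs represented =
      subst (numColours G c ≤_) (length-map c xs)
        (Unique-⊆⇒length≤ (deduplicate-! (map c (vertices G))) colours⊆)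
      where
      colours⊆ : colours ⊆ map c xs
      colours⊆ d∈ with ∈-map⁻ c (∈-deduplicate⁻ _≟_ (map c (vertices G)) d∈)
      ... | v , _ , refl with represented v
      ...   | u , u∈xs , cu≡cv = subst (_∈ map c xs) cu≡cv (∈-map⁺ c u∈xs)

    length≤numColours : ∀ (xs : List (Fin n)) → Unique xs →
      (∀ {x y} → x ∈ xs → y ∈ xs → x ≢ y → c x ≢ c y) → length xs ≤ numColours G c
    length≤numColours xs xs! c-inj =
      subst (_≤ numColours G c) (length-map c xs)
        (Unique-⊆⇒length≤ (Unique-map⁺ c c-inj xs!) map⊆colours)
      where
      map⊆colours : map c xs ⊆ colours
      map⊆colours d∈ with ∈-map⁻ c d∈
      ... | v , _ , refl = ∈-deduplicate⁺ _≟_ (∈-map⁺ c (∈-vertices v))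

    numColours≤n : numColours G c ≤ n
    numColours≤n = subst (numColours G c ≤_) (length-tabulate _)
      (numColours≤length (vertices G) λ v → v , ∈-vertices v , refl)

    BChromatic⇒numColours∸1≤deg : ∀ u → BChromatic G c u → numColours G c ∸ 1 ≤ deg G u
    BChromatic⇒numColours∸1≤deg u u-b = ∸-monoˡ-≤ 1 (numColours≤length (u ∷ neighbours) seen)
      where
      neighbours : List (Fin n)
      neighbours = filter (λ w → adj G u w Bool.≟ true) (vertices G)

      seen : ∀ w → ∃[ x ] (x ∈ u ∷ neighbours × c x ≡ c w)
      seen w with c u ≟ c w
      ... | yes cu≡cw = u , here refl , cu≡cw
      ... | no  cu≢cw with u-b w (λ cw≡cu → cu≢cw (≡.sym cw≡cu))
      ...   | x , u~x , cx≡cw = x , there (∈-filter⁺ _ (∈-vertices x) u~x) , cx≡cw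

    IsBColouring⇒numColours≤m : IsBColouring G c → numColours G c ≤ m G
    IsBColouring⇒numColours≤m (_ , has-b-vertex) =
      m-maximal k numColours≤n (numColours≤length _ represented)
      where
      k : ℕ
      k = numColours G c

      represented : ∀ v → ∃[ u ] (u ∈ filter (λ w → k ∸ 1 ≤? deg G w) (vertices G) × c u ≡ c v)
      represented v with has-b-vertex v
      ... | u , cu≡cv , u-b =
        u , ∈-filter⁺ _ (∈-vertices u) (BChromatic⇒numColours∸1≤deg u u-b) , cu≡cv

    Tight⇒m≤numColours : Tight G →
      (∀ u u' → Dense G u → Dense G u' → u ≢ u' → c u ≢ c u') → m G ≤ numColours G c
    Tight⇒m≤numColours (#dense≡m , _) c-inj =
      subst (_≤ numColours G c) #dense≡m
        (length≤numColours denseVertices (filter⁺ Dense? (tabulate⁺ (λ i≡j → i≡j))) c-inj′)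
      where
      Dense? : ∀ v → Dec (Dense G v)
      Dense? v = m G ∸ 1 ≤? deg G v

      denseVertices : List (Fin n)
      denseVertices = filter Dense? (vertices G)

      c-inj′ : ∀ {x y} → x ∈ denseVertices → y ∈ denseVertices → x ≢ y → c x ≢ c y
      c-inj′ {x} {y} x∈ y∈ = c-inj x y (proj₂ (∈-filter⁻ Dense? {xs = vertices G} x∈))
        (proj₂ (∈-filter⁻ Dense? {xs = vertices G} y∈))

mainTheorem5 : ∀ {n : ℕ} (G : Graph n) → Tight G →
    (S' : Subset n) → (∀ v → v Data.Fin.Subset.∈ S' → InδT G v) →
    (c' c : Fin n → ℕ) → IsPartialBColouring G S' c' →
    IsBPrecolouringExtension G S' c' c → IsTightBColouring G c
mainTheorem5 G tight S' _ c' c (_ , _ , c'-inj-on-T , _) (b-colouring , c≡c'-on-S'T , _) =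
  b-colouring ,
  ≤-antisym (IsBColouring⇒numColours≤m G c b-colouring)
            (Tight⇒m≤numColours G c tight c-inj-on-T)
  where
  c-inj-on-T : ∀ u u' → InT G u → InT G u' → u ≢ u' → c u ≢ c u'
  c-inj-on-T u u' u∈T u'∈T u≢u' cu≡cu' = c'-inj-on-T u u' u∈T u'∈T u≢u'
    (trans (≡.sym (c≡c'-on-S'T u (inj₂ u∈T))) (trans cu≡cu' (c≡c'-on-S'T u' (inj₂ u'∈T))))
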